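{- For an algorithm following the $\pi$-strategy and any probability measure $\mu>0$ on $\Omega$, the probability that the algorithm fails to reach a flawless state within $t$ steps is at most \[ \left(\max_{\sigma\in\Omega}\frac{\theta(\sigma)}{\mu(\sigma)}\right)\sum_{\phi=(S_0,\dots,S_t)\in\mathcal F_t}\prod_{i=1}^t\gamma_{(i)}^{S_i}, \] where $\mathcal F_t$ is the set of witness sequences $w(\Sigma)$ of bad $t$-trajectories $\Sigma$ of the algorithm.
   Context: Setting: $\Omega$ finite, flaws $f_1,\dots,f_m\subseteq\Omega$, $U(\sigma)=\{j:\sigma\in f_j\}$; for $\sigma\in f_i$, $\rho_i(\sigma,\cdot)$ is a probability distribution on $\Omega$; the initial state is drawn from $\theta$; for a permutation $\pi$ of $[m]$, the $\pi$-strategy addresses in flawed state $\sigma$ the flaw $\pi(\sigma):=\pi(U(\sigma))$ (element first according to $\pi$), moving to $\tau\sim\rho_{\pi(\sigma)}(\sigma,\cdot)$; the algorithm stops at flawless states. Introduced flaws: $\sigma\to\tau$ addressing $f_i$ introduces $f_j$ if $\tau\in f_j$ and ($\sigma\notin f_j$ or $j=i$). Primary flaw: $f_i$ such that for all $\sigma\in f_i$, $j\ne i$ with $\sigma\in f_j$, $\tau$ with $\rho_j(\sigma,\tau)>0$: $\tau\in f_i$. $T$ covers $S$ if the primary flaws of $T$ equal those of $S$ and the non-primary flaws of $T$ contain those of $S$. $\mathrm{In}_i^S(\tau)=\{\sigma\in f_i:$ flaws introduced by $\sigma\to\tau$ cover $S\}$, and $\gamma_i^S=\max_{\tau}\frac{1}{\mu(\tau)}\sum_{\sigma\in\mathrm{In}_i^S(\tau)}\mu(\sigma)\rho_i(\sigma,\tau)$.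 Bad $t$-trajectory: $(\sigma_1,\dots,\sigma_{t+1})$ with all states flawed. Witness sequence: with $A-\pi(B):=A\setminus\{\pi(B)\}$, $B_0=U(\sigma_1)$, $B_i=U(\sigma_{i+1})\setminus[U(\sigma_i)-\pi(\sigma_i)]$, $C_i=\{k\in B_i:\exists j\in[i+1,t]:k\notin U(\sigma_{j+1})\wedge\forall\ell\in[i+1,j]:k\ne\pi(\sigma_\ell)\}$, $w(\Sigma)=(B_i\setminus C_i)_{i=0}^t$. For $(S_i)_{i=0}^t$: $S_1^*=S_0$, $S_{i+1}^*=[S_i^*-\pi(S_i^*)]\cup S_i$ (if $S_i^*\neq\emptyset$), and $(i):=\pi(S_i^*)$.
   Formalization: The initial distribution θ, the measure μ and the distributions $\rho_i(\sigma,\cdot)$ take only rational values. -}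

module Defs where

open import Data.Bool using (Bool; true; false; _∧_; _∨_; not; if_then_else_)
open import Data.Bool.Properties using () renaming (_≟_ to _≟ᵇ_)
open import Data.Nat using (ℕ; zero; suc; _∸_; _≡ᵇ_) renaming (_+_ to _+ℕ_)
open import Data.Fin using (Fin; toℕ)
open import Data.Fin.Permutation using (Permutation′; _⟨$⟩ʳ_)
open import Data.List using (List; []; _∷_; map; concatMap; foldr; allFin; upTo; deduplicate)
open import Data.Bool.ListAction using (and; or)
open import Data.Maybe using (Maybe; just; nothing)
open import Data.Vec using (Vec; []; _∷_; lookup; tabulate; toList; _[_]≔_)
open import Data.Vec.Properties using (≡-dec)
open import Data.Rational using (ℚ; 0ℚ; 1ℚ; _+_; _*_; _÷_; _⊔_; _≤ᵇ_; _≤_; _<_; ≢-nonZero)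
  renaming (_≟_ to _≟ℚ_)
open import Relation.Nullary using (yes; no; does)
open import Relation.Binary.PropositionalEquality using (_≡_)
open import Data.Product using (_×_)

sumℚ : List ℚ → ℚ
sumℚ = foldr _+_ 0ℚ

prodℚ : List ℚ → ℚ
prodℚ = foldr _*_ 1ℚ

Σfin : ∀ {n} → (Fin n → ℚ) → ℚ
Σfin {n} g = sumℚ (map g (allFin n))

-- Maximum over Fin n of a nonnegative-valued function (initial value 0;
-- all functions this is applied to are nonnegative, so this is the max).
maxfin : ∀ {n} → (Fin n → ℚ) → ℚ
maxfin {n} g = foldr _⊔_ 0ℚ (map g (allFin n))

-- Total division (the divisor is always positive where used).
divℚ : ℚ → ℚ → ℚ
divℚ p q with q ≟ℚ 0ℚ
... | yes _ = 0ℚ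
... | no q≢0 = _÷_ p q {{≢-nonZero q≢0}}

allF : ∀ {n} → (Fin n → Bool) → Bool
allF {n} P = and (map P (allFin n))

anyF : ∀ {n} → (Fin n → Bool) → Bool
anyF {n} P = or (map P (allFin n))

-- range a b = [a, a+1, ..., b]  (empty if b < a)
range : ℕ → ℕ → List ℕ
range a b = map (a +ℕ_) (upTo (suc b ∸ a))

allR : ℕ → ℕ → (ℕ → Bool) → Bool
allR a b P = and (map P (range a b))

anyR : ℕ → ℕ → (ℕ → Bool) → Bool
anyR a b P = or (map P (range a b))

posᵇ : ℚ → Bool
posᵇ p = not (p ≤ᵇ 0ℚ)

_⇒ᵇ_ : Bool → Bool → Bool
a ⇒ᵇ b = not a ∨ b

_==ᵇ_ : Bool → Bool → Bool
a ==ᵇ b = does (a ≟ᵇ b)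

finEq : ∀ {m} → Fin m → Fin m → Bool
finEq i j = toℕ i ≡ᵇ toℕ j

maybeEq : ∀ {m} → Maybe (Fin m) → Fin m → Bool
maybeEq nothing  k = false
maybeEq (just a) k = finEq a k

allVecs : ∀ {n} (k : ℕ) → List (Vec (Fin n) k)
allVecs zero = [] ∷ []
allVecs {n} (suc k) = concatMap (λ x → map (x ∷_) (allVecs k)) (allFin n)

-- 1-based access to a trajectory (σ₁, …, σ_{t+1}) = vector of length t+1;
-- indices outside [1, t+1] are clamped (never used).
at : ∀ {A : Set} {t} → Vec A (suc t) → ℕ → A
at (x ∷ xs) zero = x
at (x ∷ xs) (suc zero) = x
at (x ∷ []) (suc (suc k)) = x
at (x ∷ y ∷ xs) (suc (suc k)) = at (y ∷ xs) (suc k)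

filterᵇ : ∀ {A : Set} → (A → Bool) → List A → List A
filterᵇ P [] = []
filterᵇ P (x ∷ xs) = if P x then x ∷ filterᵇ P xs else filterᵇ P xs

-- The setting.
--   Ω = Fin n, flaws f j ⊆ Ω given by f : Fin m → Fin n → Bool,
--   ρ i σ τ = ρ_i(σ, τ), θ the initial distribution, μ the measure,
--   π a permutation of [m]: the flaws in order of priority are
--   π(0), π(1), …, π(m-1).

module Setup (n m : ℕ)
             (f : Fin m → Fin n → Bool)
             (ρ : Fin m → Fin n → Fin n → ℚ)
             (θ μ : Fin n → ℚ)
             (π : Permutation′ m) where

  Sub : Set
  Sub = Vec Bool m

  _∈ˢ_ : Fin m → Sub → Bool
  j ∈ˢ B = lookup B j

  U : Fin n → Sub
  U σ = tabulate (λ j → f j σ)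

  flawed : Fin n → Bool
  flawed σ = anyF (λ j → f j σ)

  firstπ : Sub → Maybe (Fin m)
  firstπ B = go (allFin m)
    where
    go : List (Fin m) → Maybe (Fin m)
    go [] = nothing
    go (k ∷ ks) = if (π ⟨$⟩ʳ k) ∈ˢ B then just (π ⟨$⟩ʳ k) else go ks

  remove : Sub → Maybe (Fin m) → Sub
  remove A nothing = A
  remove A (just x) = A [ x ]≔ false

  _∪ˢ_ : Sub → Sub → Sub
  A ∪ˢ B = tabulate (λ j → (j ∈ˢ A) ∨ (j ∈ˢ B))

  πσ : Fin n → Maybe (Fin m)
  πσ σ = firstπ (U σ)

  step : Fin n → Fin n → ℚ
  step σ τ with πσ σ
  ... | nothing = 0ℚ
  ... | just i  = ρ i σ τ

  bad : ∀ {t} → Vec (Fin n) (suc t) → Bool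
  bad Σ = and (map flawed (toList Σ))

  weight : ∀ {t} → Vec (Fin n) (suc t) → ℚ
  weight {t} Σ = θ (at Σ 1) * prodℚ (map (λ i → step (at Σ i) (at Σ (suc i))) (range 1 t))

  possible : ∀ {t} → Vec (Fin n) (suc t) → Bool
  possible Σ = posᵇ (weight Σ)

  failProb : ℕ → ℚ
  failProb t = sumℚ (map (λ Σ → if bad Σ then weight Σ else 0ℚ) (allVecs (suc t)))

  Bset : ∀ {t} → Vec (Fin n) (suc t) → ℕ → Sub
  Bset Σ zero = U (at Σ 1)
  Bset Σ (suc i) =
    tabulate (λ k → (k ∈ˢ U (at Σ (suc (suc i))))
                  ∧ not (k ∈ˢ remove (U (at Σ (suc i))) (πσ (at Σ (suc i)))))

  Cset : ∀ {t} → Vec (Fin n) (suc t) → ℕ → Sub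
  Cset {t} Σ i =
    tabulate (λ k → (k ∈ˢ Bset Σ i)
      ∧ anyR (suc i) t (λ j → not (k ∈ˢ U (at Σ (suc j)))
                              ∧ allR (suc i) j (λ ℓ → not (maybeEq (πσ (at Σ ℓ)) k))))

  witness : ∀ {t} → Vec (Fin n) (suc t) → Vec Sub (suc t)
  witness Σ = tabulate (λ i → tabulate (λ k →
                 (k ∈ˢ Bset Σ (toℕ i)) ∧ not (k ∈ˢ Cset Σ (toℕ i))))

  _≟W_ : ∀ {t} → (x y : Vec Sub t) → _
  _≟W_ = ≡-dec (≡-dec _≟ᵇ_)

  𝓕 : (t : ℕ) → List (Vec Sub (suc t))
  𝓕 t = deduplicate _≟W_
          (map witness (filterᵇ (λ Σ → bad Σ ∧ possible Σ) (allVecs (suc t))))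

  primary : Fin m → Bool
  primary j = allF (λ σ → f j σ ⇒ᵇ
                allF (λ k → (not (finEq k j) ∧ f k σ) ⇒ᵇ
                  allF (λ τ → posᵇ (ρ k σ τ) ⇒ᵇ f j τ)))

  introduced : Fin m → Fin n → Fin n → Sub
  introduced i σ τ = tabulate (λ j → f j τ ∧ (not (f j σ) ∨ finEq j i))

  covers : Sub → Sub → Bool
  covers T S = allF (λ j → if primary j then (j ∈ˢ T) ==ᵇ (j ∈ˢ S)
                                        else ((j ∈ˢ S) ⇒ᵇ (j ∈ˢ T)))

  inIn : Fin m → Sub → Fin n → Fin n → Bool
  inIn i S τ σ = f i σ ∧ covers (introduced i σ τ) S

  γ : Fin m → Sub → ℚ
  γ i S = maxfin (λ τ → divℚ (Σfin (λ σ → if inIn i S τ σ then μ σ * ρ i σ τ else 0ℚ)) (μ τ))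

  -- ∏_{i=1}^{t} γ_{(i)}^{S_i}, with S₁* = S₀, S_{i+1}* = [S_i* - π(S_i*)] ∪ S_i,
  -- (i) = π(S_i*).  (If some S_i* were empty the factor is taken as 0; this
  -- never happens for witness sequences of bad trajectories.)
  prodγ : ∀ {t} → Vec Sub (suc t) → ℚ
  prodγ (S₀ ∷ Ss) = go S₀ (toList Ss)
    where
    go : Sub → List Sub → ℚ
    go Sst [] = 1ℚ
    go Sst (S ∷ rest) with firstπ Sst
    ... | nothing = 0ℚ
    ... | just a  = γ a S * go (remove Sst (just a) ∪ˢ S) rest

  maxRatio : ℚ
  maxRatio = maxfin (λ σ → divℚ (θ σ) (μ σ))

  bound : ℕ → ℚ
  bound t = maxRatio * sumℚ (map prodγ (𝓕 t))

IsProbDist : ∀ {n} → (Fin n → ℚ) → Set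
IsProbDist {n} p = (∀ x → 0ℚ ≤ p x) × (Σfin p ≡ 1ℚ)

{-# OPTIONS --safe #-}
module Submission where

-- The failure probability is the sum, over bad trajectories Σ = (σ₁, …, σ_{t+1}),
-- of θ(σ₁) ∏ᵢ ρ_{π(σᵢ)}(σᵢ, σᵢ₊₁) ≤ max(θ/μ) · μ(σ₁) ∏ᵢ ρ_{π(σᵢ)}(σᵢ, σᵢ₊₁).  Group the
-- trajectories by their witness sequence φ = w(Σ) = (S₀, …, S_t).  Then S_i* consists of the
-- flaws of σᵢ that do not disappear before being addressed again, so π(S_i*) is the flaw π(σᵢ)
-- addressed at step i; and since a primary flaw can only disappear by being addressed, the flaws
-- introduced by σᵢ → σᵢ₊₁ cover S_i, i.e. σᵢ ∈ In_{(i)}^{S_i}(σᵢ₊₁).  Hence every product above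
-- is a product of ρ's restricted to these In-sets.  Summing such restricted products over all
-- state sequences one state at a time, from σ₁ onwards, each step contributes at most
-- γ_{(i)}^{S_i}, since Σ_{σ ∈ In} μ(σ) ρ(σ, τ) ≤ γ μ(τ) is the definition of γ.

open import Defs
open import Data.Bool using (Bool; true; false; T; _∧_; _∨_; not; if_then_else_)
open import Data.Bool.Properties using (T-≡; T-∧; T-∨; ∨-zeroʳ; ∨-identityʳ; ∧-identityʳ)
open import Data.Empty using (⊥-elim)
open import Data.Fin using (Fin; toℕ)
import Data.Fin.Properties as Fin
open import Data.Fin.Permutation using (Permutation′; _⟨$⟩ʳ_; _⟨$⟩ˡ_; inverseʳ)
open import Data.List using (List; []; _∷_; map; foldr; concatMap; _++_; allFin; upTo; applyUpTo)
import Data.List.Properties as List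
open import Data.List.Membership.Propositional using (_∈_; find; lose)
open import Data.List.Membership.Propositional.Properties
  using (∈-allFin; ∈-map⁺; ∈-map⁻; ∈-upTo⁺; ∈-upTo⁻; ∈-applyUpTo⁺; ∈-concatMap⁺; ∈-deduplicate⁺)
open import Data.List.Relation.Unary.Any using (here; there)
import Data.List.Relation.Unary.Any as Any
import Data.List.Relation.Unary.All as All
open import Data.List.Relation.Unary.All.Properties using (all⁺; all⁻)
open import Data.List.Relation.Unary.Any.Properties using (any⁺; any⁻)
open import Data.Maybe using (Maybe; just; nothing)
open import Data.Nat using (ℕ; zero; suc; _∸_; s≤s; z≤n; _≤′_; ≤′-refl; ≤′-reflexive; ≤′-step)
  renaming (_+_ to _+ℕ_; _≤_ to _≤ℕ_; _<_ to _<ℕ_)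
import Data.Nat.Properties as ℕ
open import Data.Product using (∃; _×_; _,_; proj₁; proj₂)
open import Data.Rational using (ℚ; 0ℚ; 1ℚ; _+_; _*_; _≤_; _<_; _⊔_; _≤ᵇ_; 1/_; ≢-nonZero; nonNegative)
  renaming (_≟_ to _≟ℚ_)
import Data.Rational.Properties as ℚ
open import Algebra.Bundles using (CommutativeMonoid)
open import Algebra.Properties.CommutativeSemigroup (CommutativeMonoid.commutativeSemigroup ℚ.+-0-commutativeMonoid)
  using () renaming (interchange to +-interchange)
open import Data.Sum using (inj₁; inj₂)
open import Data.Unit using (tt)
open import Data.Vec using (Vec; []; _∷_; tabulate; toList; _[_]≔_)
import Data.Vec.Properties as Vec
open import Function using (_∘_)
open import Function.Bundles using (Equivalence)
open import Relation.Nullary using (¬_; yes; no)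
open import Relation.Binary.PropositionalEquality
  using (_≡_; _≢_; refl; sym; trans; cong; cong₂; subst; module ≡-Reasoning)

≡true⇒T : ∀ {b} → b ≡ true → T b
≡true⇒T = Equivalence.from T-≡

T⇒≡true : ∀ {b} → T b → b ≡ true
T⇒≡true = Equivalence.to T-≡

T-not⁺ : ∀ {b} → ¬ T b → T (not b)
T-not⁺ {false} _ = tt
T-not⁺ {true} ¬b = ¬b tt

T-not⁻ : ∀ {b} → T (not b) → ¬ T b
T-not⁻ {false} _ ()

T-∧⁺ : ∀ {a b} → T a → T b → T (a ∧ b)
T-∧⁺ ta tb = Equivalence.from T-∧ (ta , tb)

T-∧ˡ : ∀ {a b} → T (a ∧ b) → T a
T-∧ˡ = proj₁ ∘ Equivalence.to T-∧

T-∧ʳ : ∀ {a b} → T (a ∧ b) → T b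
T-∧ʳ {a} = proj₂ ∘ Equivalence.to (T-∧ {a})

T-⇒ᵇ⁺ : ∀ {a b} → (T a → T b) → T (a ⇒ᵇ b)
T-⇒ᵇ⁺ {false} _ = tt
T-⇒ᵇ⁺ {true} h = h tt

T-⇒ᵇ⁻ : ∀ {a b} → T (a ⇒ᵇ b) → T a → T b
T-⇒ᵇ⁻ {true} h _ = h

T-==ᵇ⁺ : ∀ {a b} → (T a → T b) → (T b → T a) → T (a ==ᵇ b)
T-==ᵇ⁺ {false} {false} _ _ = tt
T-==ᵇ⁺ {false} {true} _ b⇒a = b⇒a tt
T-==ᵇ⁺ {true} {false} a⇒b _ = a⇒b tt
T-==ᵇ⁺ {true} {true} _ _ = tt

T-ext : ∀ {a b} → (T a → T b) → (T b → T a) → a ≡ b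
T-ext {false} {false} _ _ = refl
T-ext {false} {true} _ b⇒a = ⊥-elim (b⇒a tt)
T-ext {true} {false} a⇒b _ = ⊥-elim (a⇒b tt)
T-ext {true} {true} _ _ = refl

∧-not-∧ : ∀ a b → a ∧ not (a ∧ b) ≡ a ∧ not b
∧-not-∧ false b = refl
∧-not-∧ true b = refl

∧-not-∨-cases : ∀ a b c → (a ∧ not (not b ∨ c)) ∨ ((b ∧ not a) ∧ not c) ≡ b ∧ not c
∧-not-∨-cases true true c = ∨-identityʳ (not c)
∧-not-∨-cases true false c = refl
∧-not-∨-cases false b c = cong (_∧ not c) (∧-identityʳ b)

¬T⇒≡false : ∀ {b} → ¬ T b → b ≡ false
¬T⇒≡false {false} _ = refl
¬T⇒≡false {true} ¬b = ⊥-elim (¬b tt)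

finEq-refl : ∀ {m} (i : Fin m) → T (finEq i i)
finEq-refl i = ℕ.≡⇒≡ᵇ (toℕ i) (toℕ i) refl

finEq⇒≡ : ∀ {m} {i j : Fin m} → T (finEq i j) → i ≡ j
finEq⇒≡ {i = i} {j} h = Fin.toℕ-injective (ℕ.≡ᵇ⇒≡ (toℕ i) (toℕ j) h)

finEq-≢ : ∀ {m} {i j : Fin m} → i ≢ j → finEq i j ≡ false
finEq-≢ i≢j = ¬T⇒≡false (i≢j ∘ finEq⇒≡)

allF⁻ : ∀ {k} (P : Fin k → Bool) → T (allF P) → ∀ x → T (P x)
allF⁻ {k} P h x = All.lookup (all⁺ P (allFin k) h) (∈-allFin x)

allF⁺ : ∀ {k} (P : Fin k → Bool) → (∀ x → T (P x)) → T (allF P)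
allF⁺ {k} P h = all⁻ P {allFin k} (All.tabulate (λ {x} _ → h x))

∈-range⁺ : ∀ {a b j} → a ≤ℕ j → j ≤ℕ b → j ∈ range a b
∈-range⁺ {a} {b} a≤j j≤b =
  subst (_∈ range a b) (ℕ.m+[n∸m]≡n a≤j) (∈-map⁺ (a +ℕ_) (∈-upTo⁺ (ℕ.∸-monoˡ-< (s≤s j≤b) a≤j)))

∈-range⁻ : ∀ {a b j} → j ∈ range a b → a ≤ℕ j × j ≤ℕ b
∈-range⁻ {a} {b} j∈ with ∈-map⁻ (a +ℕ_) j∈
... | i , i∈ , refl = ℕ.m≤m+n a i , subst (_≤ℕ b) (ℕ.+-comm i a) (ℕ.≤-pred (ℕ.m≤o∸n⇒m+n≤o (suc i) a≤b+1 i<))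
  where
  i< : i <ℕ suc b ∸ a
  i< = ∈-upTo⁻ i∈
  a≤b+1 : a ≤ℕ suc b
  a≤b+1 with ℕ.≤-total a (suc b)
  ... | inj₁ a≤ = a≤
  ... | inj₂ b+1≤a = ⊥-elim (ℕ.n≮0 (subst (i <ℕ_) (ℕ.m≤n⇒m∸n≡0 b+1≤a) i<))

anyR⁺ : ∀ {a b j} (P : ℕ → Bool) → a ≤ℕ j → j ≤ℕ b → T (P j) → T (anyR a b P)
anyR⁺ P a≤j j≤b pj = any⁺ P (lose (∈-range⁺ a≤j j≤b) pj)

anyR⁻ : ∀ {a b} (P : ℕ → Bool) → T (anyR a b P) → ∃ λ j → a ≤ℕ j × j ≤ℕ b × T (P j)
anyR⁻ {a} {b} P h with find (any⁻ P (range a b) h)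
... | j , j∈ , pj = j , proj₁ (∈-range⁻ j∈) , proj₂ (∈-range⁻ j∈) , pj

allR⁺ : ∀ {a b} (P : ℕ → Bool) → (∀ j → a ≤ℕ j → j ≤ℕ b → T (P j)) → T (allR a b P)
allR⁺ P h = all⁻ P (All.tabulate (λ j∈ → h _ (proj₁ (∈-range⁻ j∈)) (proj₂ (∈-range⁻ j∈))))

allR⁻ : ∀ {a b j} (P : ℕ → Bool) → T (allR a b P) → a ≤ℕ j → j ≤ℕ b → T (P j)
allR⁻ {a} {b} P h a≤j j≤b = All.lookup (all⁺ P (range a b) h) (∈-range⁺ a≤j j≤b)

-- Finite sums, products and maxima of rationals

private variable A B : Set

sumMap : List A → (A → ℚ) → ℚ
sumMap xs g = sumℚ (map g xs)

sumMap-cong : ∀ xs {g h : A → ℚ} → (∀ x → g x ≡ h x) → sumMap xs g ≡ sumMap xs h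
sumMap-cong [] _ = refl
sumMap-cong (x ∷ xs) g≗h = cong₂ _+_ (g≗h x) (sumMap-cong xs g≗h)

sumMap-mono-≤ : ∀ xs {g h : A → ℚ} → (∀ x → g x ≤ h x) → sumMap xs g ≤ sumMap xs h
sumMap-mono-≤ [] _ = ℚ.≤-refl
sumMap-mono-≤ (x ∷ xs) g≤h = ℚ.+-mono-≤ (g≤h x) (sumMap-mono-≤ xs g≤h)

sumMap-nonneg : ∀ xs {g : A → ℚ} → (∀ x → 0ℚ ≤ g x) → 0ℚ ≤ sumMap xs g
sumMap-nonneg [] _ = ℚ.≤-refl
sumMap-nonneg (x ∷ xs) 0≤g = ℚ.+-mono-≤ (0≤g x) (sumMap-nonneg xs 0≤g)

≤-sumMap : ∀ {xs x} (g : A → ℚ) → (∀ y → 0ℚ ≤ g y) → x ∈ xs → g x ≤ sumMap xs g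
≤-sumMap {xs = y ∷ xs} g 0≤g (here refl) =
  ℚ.≤-trans (ℚ.≤-reflexive (sym (ℚ.+-identityʳ (g y)))) (ℚ.+-mono-≤ (ℚ.≤-refl {g y}) (sumMap-nonneg xs 0≤g))
≤-sumMap {xs = y ∷ _} g 0≤g (there x∈) =
  ℚ.≤-trans (≤-sumMap g 0≤g x∈) (ℚ.≤-trans (ℚ.≤-reflexive (sym (ℚ.+-identityˡ _))) (ℚ.+-mono-≤ (0≤g y) ℚ.≤-refl))

sumMap-*ˡ : ∀ xs c (g : A → ℚ) → sumMap xs (λ x → c * g x) ≡ c * sumMap xs g
sumMap-*ˡ [] c _ = sym (ℚ.*-zeroʳ c)
sumMap-*ˡ (x ∷ xs) c g = trans (cong (c * g x +_) (sumMap-*ˡ xs c g)) (sym (ℚ.*-distribˡ-+ c (g x) _))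

sumMap-*ʳ : ∀ xs c (g : A → ℚ) → sumMap xs (λ x → g x * c) ≡ sumMap xs g * c
sumMap-*ʳ [] c _ = sym (ℚ.*-zeroˡ c)
sumMap-*ʳ (x ∷ xs) c g = trans (cong (g x * c +_) (sumMap-*ʳ xs c g)) (sym (ℚ.*-distribʳ-+ c (g x) _))

sumMap-0 : ∀ xs → sumMap xs (λ (_ : A) → 0ℚ) ≡ 0ℚ
sumMap-0 [] = refl
sumMap-0 (_ ∷ xs) = cong (0ℚ +_) (sumMap-0 xs)

sumMap-+ : ∀ xs (g h : A → ℚ) → sumMap xs (λ x → g x + h x) ≡ sumMap xs g + sumMap xs h
sumMap-+ [] _ _ = refl
sumMap-+ (x ∷ xs) g h =
  trans (cong ((g x + h x) +_) (sumMap-+ xs g h)) (+-interchange (g x) (h x) (sumMap xs g) (sumMap xs h))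

sumMap-++ : ∀ xs ys (g : A → ℚ) → sumMap (xs ++ ys) g ≡ sumMap xs g + sumMap ys g
sumMap-++ [] ys g = sym (ℚ.+-identityˡ _)
sumMap-++ (x ∷ xs) ys g = trans (cong (g x +_) (sumMap-++ xs ys g)) (sym (ℚ.+-assoc (g x) _ _))

sumMap-map : ∀ xs (h : A → B) (g : B → ℚ) → sumMap (map h xs) g ≡ sumMap xs (g ∘ h)
sumMap-map xs h g = cong sumℚ (sym (List.map-∘ {g = g} {f = h} xs))

sumMap-concatMap : ∀ xs (h : A → List B) (g : B → ℚ) →
                   sumMap (concatMap h xs) g ≡ sumMap xs (λ x → sumMap (h x) g)
sumMap-concatMap [] h g = refl
sumMap-concatMap (x ∷ xs) h g =
  trans (sumMap-++ (h x) (concatMap h xs) g) (cong (sumMap (h x) g +_) (sumMap-concatMap xs h g))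

sumMap-swap : ∀ xs ys (g : A → B → ℚ) →
              sumMap xs (λ x → sumMap ys (g x)) ≡ sumMap ys (λ y → sumMap xs (λ x → g x y))
sumMap-swap [] ys g = sym (sumMap-0 ys)
sumMap-swap (x ∷ xs) ys g =
  trans (cong (sumMap ys (g x) +_) (sumMap-swap xs ys g)) (sym (sumMap-+ ys (g x) (λ y → sumMap xs (λ x′ → g x′ y))))

prodℚ-zero : ∀ {xs} → 0ℚ ∈ xs → prodℚ xs ≡ 0ℚ
prodℚ-zero {_ ∷ xs} (here refl) = ℚ.*-zeroˡ (prodℚ xs)
prodℚ-zero {x ∷ _} (there 0∈) = trans (cong (x *_) (prodℚ-zero 0∈)) (ℚ.*-zeroʳ x)

module _ (g : A → ℚ) where

  ≤-foldr-⊔ : ∀ {xs x} → x ∈ xs → g x ≤ foldr _⊔_ 0ℚ (map g xs)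
  ≤-foldr-⊔ {y ∷ _} (here refl) = ℚ.p≤p⊔q (g y) _
  ≤-foldr-⊔ {y ∷ _} (there x∈) = ℚ.≤-trans (≤-foldr-⊔ x∈) (ℚ.p≤q⊔p (g y) _)

  foldr-⊔-nonneg : ∀ xs → 0ℚ ≤ foldr _⊔_ 0ℚ (map g xs)
  foldr-⊔-nonneg [] = ℚ.≤-refl
  foldr-⊔-nonneg (y ∷ ys) = ℚ.≤-trans (foldr-⊔-nonneg ys) (ℚ.p≤q⊔p (g y) _)

divℚ-*-cancel : ∀ p {q} → 0ℚ < q → divℚ p q * q ≡ p
divℚ-*-cancel p {q} 0<q with q ≟ℚ 0ℚ
... | yes q≡0 = ⊥-elim (ℚ.<-irrefl (sym q≡0) 0<q)
... | no q≢0 = begin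
  (p * (1/ q) {{≢-nonZero q≢0}}) * q ≡⟨ ℚ.*-assoc p _ q ⟩
  p * ((1/ q) {{≢-nonZero q≢0}} * q) ≡⟨ cong (p *_) (ℚ.*-inverseˡ q {{≢-nonZero q≢0}}) ⟩
  p * 1ℚ                             ≡⟨ ℚ.*-identityʳ p ⟩
  p                                  ∎
  where open ≡-Reasoning

*-nonneg : ∀ {p q} → 0ℚ ≤ p → 0ℚ ≤ q → 0ℚ ≤ p * q
*-nonneg {p} 0≤p 0≤q =
  ℚ.≤-trans (ℚ.≤-reflexive (sym (ℚ.*-zeroʳ p))) (ℚ.*-monoˡ-≤-nonNeg p {{nonNegative 0≤p}} 0≤q)

*-monoˡ-≤ : ∀ {r p q} → 0ℚ ≤ r → p ≤ q → r * p ≤ r * q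
*-monoˡ-≤ {r} 0≤r = ℚ.*-monoˡ-≤-nonNeg r {{nonNegative 0≤r}}

*-monoʳ-≤ : ∀ {r p q} → 0ℚ ≤ r → p ≤ q → p * r ≤ q * r
*-monoʳ-≤ {r} 0≤r = ℚ.*-monoʳ-≤-nonNeg r {{nonNegative 0≤r}}

divℚ≤⇒≤* : ∀ p {q c} → 0ℚ < q → divℚ p q ≤ c → p ≤ c * q
divℚ≤⇒≤* p {q} 0<q p/q≤c =
  ℚ.≤-trans (ℚ.≤-reflexive (sym (divℚ-*-cancel p 0<q))) (*-monoʳ-≤ (ℚ.<⇒≤ 0<q) p/q≤c)

posᵇ⁺ : ∀ {p} → 0ℚ ≤ p → p ≢ 0ℚ → T (posᵇ p)
posᵇ⁺ 0≤p p≢0 = T-not⁺ (λ p≤0 → p≢0 (ℚ.≤-antisym (ℚ.≤ᵇ⇒≤ p≤0) 0≤p))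

posᵇ⇒≢0 : ∀ {p} → T (posᵇ p) → p ≢ 0ℚ
posᵇ⇒≢0 pos refl = pos

¬posᵇ⇒≤0 : ∀ {p} → ¬ T (posᵇ p) → p ≤ 0ℚ
¬posᵇ⇒≤0 {p} ¬pos with p ≤ᵇ 0ℚ in eq
... | true = ℚ.≤ᵇ⇒≤ (≡true⇒T eq)
... | false = ⊥-elim (¬pos tt)

∈-allVecs : ∀ {n} k (v : Vec (Fin n) k) → v ∈ allVecs k
∈-allVecs zero [] = here refl
∈-allVecs (suc k) (x ∷ v) =
  ∈-concatMap⁺ (λ y → map (y ∷_) (allVecs k)) (Any.map (λ { refl → ∈-map⁺ (x ∷_) (∈-allVecs k v) }) (∈-allFin x))

sumMap-allVecs-suc : ∀ {n} k (F : Vec (Fin n) (suc k) → ℚ) →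
                     sumMap (allVecs (suc k)) F ≡ sumMap (allFin n) (λ x → sumMap (allVecs k) (λ w → F (x ∷ w)))
sumMap-allVecs-suc {n} k F = trans (sumMap-concatMap (allFin n) (λ x → map (x ∷_) (allVecs k)) F)
  (sumMap-cong (allFin n) (λ x → sumMap-map (allVecs k) (x ∷_) F))

∈-filterᵇ⁺ : ∀ (P : A → Bool) {xs x} → x ∈ xs → T (P x) → x ∈ filterᵇ P xs
∈-filterᵇ⁺ P {y ∷ _} (here refl) px with P y
... | true = here refl
... | false = ⊥-elim px
∈-filterᵇ⁺ P {y ∷ _} (there x∈) px with P y
... | true = there (∈-filterᵇ⁺ P x∈ px)
... | false = ∈-filterᵇ⁺ P x∈ px

at-∈-toList : ∀ {L} (v : Vec A (suc L)) i → at v i ∈ toList v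
at-∈-toList (x ∷ _) zero = here refl
at-∈-toList (x ∷ _) (suc zero) = here refl
at-∈-toList (x ∷ []) (suc (suc _)) = here refl
at-∈-toList (x ∷ y ∷ v) (suc (suc i)) = there (at-∈-toList (y ∷ v) (suc i))

-- The π-strategy

module Strategy (n m : ℕ)
                (f : Fin m → Fin n → Bool)
                (ρ : Fin m → Fin n → Fin n → ℚ)
                (θ μ : Fin n → ℚ)
                (π : Permutation′ m) where

  open Setup n m f ρ θ μ π

  firstOf : Sub → List (Fin m) → Maybe (Fin m)
  firstOf B [] = nothing
  firstOf B (k ∷ ks) = if (π ⟨$⟩ʳ k) ∈ˢ B then just (π ⟨$⟩ʳ k) else firstOf B ks

  firstOf-unique : ∀ B {loop : List (Fin m) → Maybe (Fin m)} → loop [] ≡ nothing →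
                   (∀ k ks → loop (k ∷ ks) ≡ (if (π ⟨$⟩ʳ k) ∈ˢ B then just (π ⟨$⟩ʳ k) else loop ks)) →
                   ∀ ks → loop ks ≡ firstOf B ks
  firstOf-unique B nil cons [] = nil
  firstOf-unique B nil cons (k ∷ ks) rewrite cons k ks | firstOf-unique B nil cons ks = refl

  -- The search loop inside firstπ is a local function that cannot be named; the
  -- underscore below is solved to it by the use in firstπ≡firstOf.
  mutual
    firstπ≡firstOf : ∀ B → firstπ B ≡ firstOf B (allFin m)
    firstπ≡firstOf B with allFin m
    ... | ks = firstπ-loop≡firstOf B ks

    firstπ-loop≡firstOf : ∀ B ks → _ ≡ firstOf B ks
    firstπ-loop≡firstOf B = firstOf-unique B refl (λ _ _ → refl)

  firstOf-∈ : ∀ B ks {a} → firstOf B ks ≡ just a → T (a ∈ˢ B)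
  firstOf-∈ B (k ∷ ks) eq with (π ⟨$⟩ʳ k) ∈ˢ B in k∈B
  firstOf-∈ B (k ∷ ks) refl | true = ≡true⇒T k∈B
  ... | false = firstOf-∈ B ks eq

  firstOf-nothing : ∀ B ks {k} → firstOf B ks ≡ nothing → k ∈ ks → ¬ T ((π ⟨$⟩ʳ k) ∈ˢ B)
  firstOf-nothing B (k ∷ ks) eq k∈ with (π ⟨$⟩ʳ k) ∈ˢ B in k∈B
  firstOf-nothing B (k ∷ ks) () k∈ | true
  firstOf-nothing B (k ∷ ks) eq (here refl) | false = subst T k∈B
  firstOf-nothing B (k ∷ ks) eq (there k∈) | false = firstOf-nothing B ks eq k∈

  firstOf-⊆ : ∀ A B ks {a} → (∀ j → T (j ∈ˢ B) → T (j ∈ˢ A)) →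
              firstOf A ks ≡ just a → T (a ∈ˢ B) → firstOf B ks ≡ just a
  firstOf-⊆ A B (k ∷ ks) B⊆A eq a∈B with (π ⟨$⟩ʳ k) ∈ˢ A in k∈A | (π ⟨$⟩ʳ k) ∈ˢ B in k∈B
  firstOf-⊆ A B (k ∷ ks) B⊆A refl a∈B | true | true = refl
  firstOf-⊆ A B (k ∷ ks) B⊆A refl a∈B | true | false = ⊥-elim (subst T k∈B a∈B)
  ... | false | true = ⊥-elim (subst T k∈A (B⊆A _ (≡true⇒T k∈B)))
  ... | false | false = firstOf-⊆ A B ks B⊆A eq a∈B

  firstπ-∈ : ∀ B {a} → firstπ B ≡ just a → T (a ∈ˢ B)
  firstπ-∈ B eq = firstOf-∈ B (allFin m) (trans (sym (firstπ≡firstOf B)) eq)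

  firstπ-nothing : ∀ B j → firstπ B ≡ nothing → ¬ T (j ∈ˢ B)
  firstπ-nothing B j eq =
    subst (λ i → ¬ T (i ∈ˢ B)) (inverseʳ π)
      (firstOf-nothing B (allFin m) (trans (sym (firstπ≡firstOf B)) eq) (∈-allFin (π ⟨$⟩ˡ j)))

  firstπ-⊆ : ∀ A B {a} → (∀ j → T (j ∈ˢ B) → T (j ∈ˢ A)) →
             firstπ A ≡ just a → T (a ∈ˢ B) → firstπ B ≡ just a
  firstπ-⊆ A B B⊆A eq a∈B =
    trans (firstπ≡firstOf B) (firstOf-⊆ A B (allFin m) B⊆A (trans (sym (firstπ≡firstOf A)) eq) a∈B)

  lookup-U : ∀ σ k → k ∈ˢ U σ ≡ f k σ
  lookup-U σ k = Vec.lookup∘tabulate (λ j → f j σ) k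

  πσ-flaw : ∀ σ {a} → πσ σ ≡ just a → T (f a σ)
  πσ-flaw σ eq = subst T (lookup-U σ _) (firstπ-∈ (U σ) eq)

  flawed⇒πσ : ∀ σ → T (flawed σ) → ∃ λ a → πσ σ ≡ just a
  flawed⇒πσ σ fl with πσ σ in eq
  ... | just a = a , refl
  ... | nothing with find (any⁻ (λ j → f j σ) (allFin m) fl)
  ...   | j , _ , fj = ⊥-elim (firstπ-nothing (U σ) j eq (subst T (sym (lookup-U σ j)) fj))

  step-just : ∀ σ τ {a} → πσ σ ≡ just a → step σ τ ≡ ρ a σ τ
  step-just σ τ eq with πσ σ
  step-just σ τ refl | just _ = refl

  primary-persists : ∀ {j b σ τ} → T (primary j) → T (f j σ) → T (f b σ) → b ≢ j →
                     T (posᵇ (ρ b σ τ)) → T (f j τ)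
  primary-persists {b = b} {σ} {τ} prim fj fb b≢j pos =
    T-⇒ᵇ⁻ (allF⁻ _ (T-⇒ᵇ⁻ (allF⁻ _ (T-⇒ᵇ⁻ (allF⁻ _ prim σ) fj) b) (T-∧⁺ (T-not⁺ (b≢j ∘ finEq⇒≡)) fb)) τ) pos

  covers⁺ : ∀ {T′ S} → (∀ j → T (j ∈ˢ S) → T (j ∈ˢ T′)) → (∀ j → T (primary j) → T (j ∈ˢ T′) → T (j ∈ˢ S)) →
            T (covers T′ S)
  covers⁺ {T′} {S} S⊆T′ primary-agree = allF⁺ _ covers-at
    where
    covers-at : ∀ j → T (if primary j then (j ∈ˢ T′) ==ᵇ (j ∈ˢ S) else ((j ∈ˢ S) ⇒ᵇ (j ∈ˢ T′)))
    covers-at j with primary j in prim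
    ... | true = T-==ᵇ⁺ (primary-agree j (≡true⇒T prim)) (S⊆T′ j)
    ... | false = T-⇒ᵇ⁺ (S⊆T′ j)

  advance : Sub → Sub → Sub
  advance S* S = remove S* (firstπ S*) ∪ˢ S

  γ-factor : Sub → Sub → ℚ
  γ-factor S* S with firstπ S*
  ... | nothing = 0ℚ
  ... | just a = γ a S

  prodγ-∷ : ∀ {L} S* S (Ss : Vec Sub L) → prodγ (S* ∷ S ∷ Ss) ≡ γ-factor S* S * prodγ (advance S* S ∷ Ss)
  prodγ-∷ S* S Ss with firstπ S*
  ... | nothing = sym (ℚ.*-zeroˡ (prodγ ((S* ∪ˢ S) ∷ Ss)))
  ... | just a = refl

  restrictedStep : Sub → Sub → Fin n → Fin n → ℚ
  restrictedStep S* S σ τ with firstπ S*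
  ... | nothing = 0ℚ
  ... | just a = if inIn a S τ σ then ρ a σ τ else 0ℚ

  restrictedStep-just : ∀ S* S σ τ {a} → firstπ S* ≡ just a → T (inIn a S τ σ) → restrictedStep S* S σ τ ≡ ρ a σ τ
  restrictedStep-just S* S σ τ eq in-In with firstπ S*
  restrictedStep-just S* S σ τ refl in-In | just a with inIn a S τ σ
  ... | true = refl

  -- S* runs through S₁*, S₂*, … as in prodγ; σ ℓ is the state σ_{ℓ+1}.
  chainWeight : ∀ {L} → Sub → Vec Sub L → (ℕ → Fin n) → ℚ
  chainWeight S* [] σ = 1ℚ
  chainWeight S* (S ∷ Ss) σ = restrictedStep S* S (σ 0) (σ 1) * chainWeight (advance S* S) Ss (σ ∘ suc)

  witnessWeight : ∀ {L} → Vec Sub (suc L) → Vec (Fin n) (suc L) → ℚ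
  witnessWeight (S₀ ∷ Ss) v = μ (at v 1) * chainWeight S₀ Ss (at v ∘ suc)

  chainWeight-tabulate : ∀ L (S* S : ℕ → Sub) (σ : ℕ → Fin n) (g : ℕ → ℚ) →
                         (∀ ℓ → ℓ <ℕ L → S* (suc ℓ) ≡ advance (S* ℓ) (S ℓ)) →
                         (∀ ℓ → ℓ <ℕ L → restrictedStep (S* ℓ) (S ℓ) (σ ℓ) (σ (suc ℓ)) ≡ g ℓ) →
                         chainWeight (S* 0) (tabulate {n = L} (S ∘ toℕ)) σ ≡ prodℚ (applyUpTo g L)
  chainWeight-tabulate zero S* S σ g _ _ = refl
  chainWeight-tabulate (suc L) S* S σ g advances steps = cong₂ _*_ (steps 0 (s≤s z≤n))
    (trans (cong (λ X → chainWeight X (tabulate {n = L} (S ∘ suc ∘ toℕ)) (σ ∘ suc)) (sym (advances 0 (s≤s z≤n))))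
           (chainWeight-tabulate L (S* ∘ suc) (S ∘ suc) (σ ∘ suc) (g ∘ suc)
             (λ ℓ ℓ<L → advances (suc ℓ) (s≤s ℓ<L)) (λ ℓ ℓ<L → steps (suc ℓ) (s≤s ℓ<L))))

  module Bounds (ρ-nonneg : ∀ {a σ} τ → T (f a σ) → 0ℚ ≤ ρ a σ τ)
                (μ-pos : ∀ σ → 0ℚ < μ σ)
                (μ-total≤1 : Σfin μ ≤ 1ℚ) where

    μ-nonneg : ∀ σ → 0ℚ ≤ μ σ
    μ-nonneg σ = ℚ.<⇒≤ (μ-pos σ)

    restrictedStep-nonneg : ∀ S* S σ τ → 0ℚ ≤ restrictedStep S* S σ τ
    restrictedStep-nonneg S* S σ τ with firstπ S*
    ... | nothing = ℚ.≤-refl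
    ... | just a with inIn a S τ σ in in-In
    ...   | true = ρ-nonneg τ (T-∧ˡ (≡true⇒T in-In))
    ...   | false = ℚ.≤-refl

    chainWeight-nonneg : ∀ {L} S* (Ss : Vec Sub L) σ → 0ℚ ≤ chainWeight S* Ss σ
    chainWeight-nonneg S* [] σ = ℚ.≤ᵇ⇒≤ tt
    chainWeight-nonneg S* (S ∷ Ss) σ =
      *-nonneg (restrictedStep-nonneg S* S (σ 0) (σ 1)) (chainWeight-nonneg (advance S* S) Ss (σ ∘ suc))

    witnessWeight-nonneg : ∀ {L} (φ : Vec Sub (suc L)) v → 0ℚ ≤ witnessWeight φ v
    witnessWeight-nonneg (S₀ ∷ Ss) v = *-nonneg (μ-nonneg (at v 1)) (chainWeight-nonneg S₀ Ss (at v ∘ suc))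

    γ-factor-nonneg : ∀ S* S → 0ℚ ≤ γ-factor S* S
    γ-factor-nonneg S* S with firstπ S*
    ... | nothing = ℚ.≤-refl
    ... | just a = foldr-⊔-nonneg _ (allFin n)

    inflow≤γ-factor : ∀ S* S τ → sumMap (allFin n) (λ σ → μ σ * restrictedStep S* S σ τ) ≤ γ-factor S* S * μ τ
    inflow≤γ-factor S* S τ with firstπ S*
    ... | nothing = ℚ.≤-reflexive (begin
      sumMap (allFin n) (λ σ → μ σ * 0ℚ) ≡⟨ sumMap-cong (allFin n) (λ σ → ℚ.*-zeroʳ (μ σ)) ⟩
      sumMap (allFin n) (λ _ → 0ℚ)       ≡⟨ sumMap-0 (allFin n) ⟩
      0ℚ                                 ≡⟨ sym (ℚ.*-zeroˡ (μ τ)) ⟩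
      0ℚ * μ τ                           ∎)
      where open ≡-Reasoning
    ... | just a = ℚ.≤-trans (ℚ.≤-reflexive (sumMap-cong (allFin n) μ*restricted))
      (divℚ≤⇒≤* _ (μ-pos τ) (≤-foldr-⊔ (λ τ′ → divℚ (inflow τ′) (μ τ′)) (∈-allFin τ)))
      where
      inflow : Fin n → ℚ
      inflow τ′ = Σfin (λ σ → if inIn a S τ′ σ then μ σ * ρ a σ τ′ else 0ℚ)
      μ*restricted : ∀ σ → μ σ * (if inIn a S τ σ then ρ a σ τ else 0ℚ) ≡ (if inIn a S τ σ then μ σ * ρ a σ τ else 0ℚ)
      μ*restricted σ with inIn a S τ σ
      ... | true = refl
      ... | false = ℚ.*-zeroʳ (μ σ)

    witnessWeight-∷ : ∀ {L} S* S (Ss : Vec Sub L) x (w : Vec (Fin n) (suc L)) →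
                      witnessWeight (S* ∷ S ∷ Ss) (x ∷ w)
                        ≡ (μ x * restrictedStep S* S x (at w 1)) * chainWeight (advance S* S) Ss (at w ∘ suc)
    witnessWeight-∷ S* S Ss x (y ∷ w) = sym (ℚ.*-assoc (μ x) _ _)

    sum-witnessWeight≤prodγ : ∀ {L} (φ : Vec Sub (suc L)) → sumMap (allVecs (suc L)) (witnessWeight φ) ≤ prodγ φ
    sum-witnessWeight≤prodγ (S* ∷ []) = ℚ.≤-trans (ℚ.≤-reflexive (begin
      sumMap (allVecs 1) (witnessWeight (S* ∷ []))
        ≡⟨ sumMap-allVecs-suc 0 (witnessWeight (S* ∷ [])) ⟩
      sumMap (allFin n) (λ x → μ x * 1ℚ + 0ℚ)
        ≡⟨ sumMap-cong (allFin n) (λ x → trans (ℚ.+-identityʳ _) (ℚ.*-identityʳ (μ x))) ⟩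
      sumMap (allFin n) μ ∎)) μ-total≤1
      where open ≡-Reasoning
    sum-witnessWeight≤prodγ {suc L} (S* ∷ S ∷ Ss) = begin
      sumMap (allVecs (suc (suc L))) (witnessWeight (S* ∷ S ∷ Ss))
        ≡⟨ sumMap-allVecs-suc (suc L) (witnessWeight (S* ∷ S ∷ Ss)) ⟩
      sumMap (allFin n) (λ x → sumMap (allVecs (suc L)) (λ w → witnessWeight (S* ∷ S ∷ Ss) (x ∷ w)))
        ≡⟨ sumMap-cong (allFin n) (λ x → sumMap-cong (allVecs (suc L)) (witnessWeight-∷ S* S Ss x)) ⟩
      sumMap (allFin n) (λ x → sumMap (allVecs (suc L)) (λ w → (μ x * r x (at w 1)) * c w))
        ≡⟨ sumMap-swap (allFin n) (allVecs (suc L)) (λ x w → (μ x * r x (at w 1)) * c w) ⟩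
      sumMap (allVecs (suc L)) (λ w → sumMap (allFin n) (λ x → (μ x * r x (at w 1)) * c w))
        ≡⟨ sumMap-cong (allVecs (suc L)) (λ w → sumMap-*ʳ (allFin n) (c w) (λ x → μ x * r x (at w 1))) ⟩
      sumMap (allVecs (suc L)) (λ w → sumMap (allFin n) (λ x → μ x * r x (at w 1)) * c w)
        ≤⟨ sumMap-mono-≤ (allVecs (suc L)) (λ w → *-monoʳ-≤ (c-nonneg w) (inflow≤γ-factor S* S (at w 1))) ⟩
      sumMap (allVecs (suc L)) (λ w → (γ-factor S* S * μ (at w 1)) * c w)
        ≡⟨ sumMap-cong (allVecs (suc L)) (λ w → ℚ.*-assoc (γ-factor S* S) (μ (at w 1)) (c w)) ⟩
      sumMap (allVecs (suc L)) (λ w → γ-factor S* S * witnessWeight (advance S* S ∷ Ss) w)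
        ≡⟨ sumMap-*ˡ (allVecs (suc L)) (γ-factor S* S) (witnessWeight (advance S* S ∷ Ss)) ⟩
      γ-factor S* S * sumMap (allVecs (suc L)) (witnessWeight (advance S* S ∷ Ss))
        ≤⟨ *-monoˡ-≤ (γ-factor-nonneg S* S) (sum-witnessWeight≤prodγ (advance S* S ∷ Ss)) ⟩
      γ-factor S* S * prodγ (advance S* S ∷ Ss)
        ≡⟨ sym (prodγ-∷ S* S Ss) ⟩
      prodγ (S* ∷ S ∷ Ss) ∎
      where
      open ℚ.≤-Reasoning
      r : Fin n → Fin n → ℚ
      r = restrictedStep S* S
      c : Vec (Fin n) (suc L) → ℚ
      c w = chainWeight (advance S* S) Ss (at w ∘ suc)
      c-nonneg : ∀ w → 0ℚ ≤ c w
      c-nonneg w = chainWeight-nonneg (advance S* S) Ss (at w ∘ suc)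

    module Trajectory {t : ℕ} (Σv : Vec (Fin n) (suc t)) (bad-Σv : T (bad Σv)) (possible-Σv : T (possible Σv)) where

      s : ℕ → Fin n
      s = at Σv

      s-flawed : ∀ i → T (flawed (s i))
      s-flawed i = All.lookup (all⁺ flawed (toList Σv) bad-Σv) (at-∈-toList Σv i)

      -- s is 1-based like the σᵢ of the paper, whereas steps ℓ are counted from 0.
      stepWeight : ℕ → ℚ
      stepWeight ℓ = step (s (suc ℓ)) (s (suc (suc ℓ)))

      weight≡ : weight Σv ≡ θ (s 1) * prodℚ (applyUpTo stepWeight t)
      weight≡ = cong (λ xs → θ (s 1) * prodℚ xs) (trans (sym (List.map-∘ (upTo t))) (List.map-upTo stepWeight t))

      ρ-step-pos : ∀ p {a} → p <ℕ t → πσ (s (suc p)) ≡ just a → T (posᵇ (ρ a (s (suc p)) (s (suc (suc p)))))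
      ρ-step-pos p {a} p<t eq = posᵇ⁺ (ρ-nonneg _ (πσ-flaw _ eq)) ρ≢0
        where
        ρ≢0 : ρ a (s (suc p)) (s (suc (suc p))) ≢ 0ℚ
        ρ≢0 ρ≡0 = posᵇ⇒≢0 possible-Σv (begin
          weight Σv                                 ≡⟨ weight≡ ⟩
          θ (s 1) * prodℚ (applyUpTo stepWeight t) ≡⟨ cong (θ (s 1) *_) (prodℚ-zero 0∈) ⟩
          θ (s 1) * 0ℚ                              ≡⟨ ℚ.*-zeroʳ (θ (s 1)) ⟩
          0ℚ                                        ∎)
          where
          open ≡-Reasoning
          0∈ : 0ℚ ∈ applyUpTo stepWeight t
          0∈ = subst (_∈ applyUpTo stepWeight t) (trans (step-just _ _ eq) ρ≡0) (∈-applyUpTo⁺ stepWeight p<t)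

      unaddressedAt : Fin m → ℕ → Bool
      unaddressedAt k ℓ = not (maybeEq (πσ (s ℓ)) k)

      -- Opaque so that unification does not unfold these predicates into list folds.
      opaque
        unaddressed : ℕ → ℕ → Fin m → Bool
        unaddressed i j k = allR i j (unaddressedAt k)

        unaddressed⁺ : ∀ {i j k} → (∀ ℓ → i ≤ℕ ℓ → ℓ ≤ℕ j → T (unaddressedAt k ℓ)) → T (unaddressed i j k)
        unaddressed⁺ {i} {j} {k} = allR⁺ {i} {j} (unaddressedAt k)

        unaddressed⁻ : ∀ {i j k ℓ} → T (unaddressed i j k) → i ≤ℕ ℓ → ℓ ≤ℕ j → T (unaddressedAt k ℓ)
        unaddressed⁻ {i} {j} {k} = allR⁻ {i} {j} (unaddressedAt k)

      opaque
        unfolding unaddressed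

        fixedUnaddressedAt : ℕ → Fin m → ℕ → Bool
        fixedUnaddressedAt i k j = not (k ∈ˢ U (s (suc j))) ∧ unaddressed i j k

        -- Flaw k disappears at some σ_{j+1} with i ≤ j ≤ t without being addressed at σᵢ … σⱼ;
        -- the paper's C_i is B_i ∩ fixedUnaddressed (i + 1).
        fixedUnaddressed : ℕ → Fin m → Bool
        fixedUnaddressed i k = anyR i t (fixedUnaddressedAt i k)

        fixedUnaddressed⁺ : ∀ {i j k} → i ≤ℕ j → j ≤ℕ t → ¬ T (f k (s (suc j))) → T (unaddressed i j k) →
                            T (fixedUnaddressed i k)
        fixedUnaddressed⁺ {i} {j} {k} i≤j j≤t ¬fk unaddr = anyR⁺ {i} {t} {j} (fixedUnaddressedAt i k) i≤j j≤t
          (T-∧⁺ {not (k ∈ˢ U (s (suc j)))} {unaddressed i j k}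
                (T-not⁺ (¬fk ∘ subst T (lookup-U (s (suc j)) k))) unaddr)

        fixedUnaddressed⁻ : ∀ {i k} → T (fixedUnaddressed i k) →
                            ∃ λ j → i ≤ℕ j × j ≤ℕ t × ¬ T (f k (s (suc j))) × T (unaddressed i j k)
        fixedUnaddressed⁻ {i} {k} fixed with anyR⁻ {i} {t} (fixedUnaddressedAt i k) fixed
        ... | j , i≤j , j≤t , p =
          j , i≤j , j≤t , T-not⁻ (T-∧ˡ {not (k ∈ˢ U (s (suc j)))} p) ∘ subst T (sym (lookup-U (s (suc j)) k)) ,
          T-∧ʳ {not (k ∈ˢ U (s (suc j)))} p

        lookup-Cset : ∀ i k → k ∈ˢ Cset Σv i ≡ (k ∈ˢ Bset Σv i) ∧ fixedUnaddressed (suc i) k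
        lookup-Cset i k = Vec.lookup∘tabulate (λ k → (k ∈ˢ Bset Σv i) ∧ fixedUnaddressed (suc i) k) k

      -- The closed form of S_i*.
      pending : ℕ → Sub
      pending i = tabulate (λ k → (k ∈ˢ U (s i)) ∧ not (fixedUnaddressed i k))

      -- witness Σv is tabulate (witnessAt ∘ toℕ) by definition.
      witnessAt : ℕ → Sub
      witnessAt i = tabulate (λ k → (k ∈ˢ Bset Σv i) ∧ not (k ∈ˢ Cset Σv i))

      unaddressed⇒≢ : ∀ {i j ℓ k b} → T (unaddressed i j k) → i ≤ℕ ℓ → ℓ ≤ℕ j → πσ (s ℓ) ≡ just b → b ≢ k
      unaddressed⇒≢ {k = k} unaddr i≤ℓ ℓ≤j eq refl =
        T-not⁻ (subst (λ x → T (not (maybeEq x k))) eq (unaddressed⁻ unaddr i≤ℓ ℓ≤j)) (finEq-refl k)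

      unaddressed-tail : ∀ {i j k} → T (unaddressed i j k) → T (unaddressed (suc i) j k)
      unaddressed-tail unaddr = unaddressed⁺ (λ ℓ i<ℓ ℓ≤j → unaddressed⁻ unaddr (ℕ.<⇒≤ i<ℓ) ℓ≤j)

      unaddressed-∅ : ∀ {i k} → T (unaddressed (suc i) i k)
      unaddressed-∅ = unaddressed⁺ (λ ℓ i<ℓ ℓ≤i → ⊥-elim (ℕ.<-irrefl refl (ℕ.<-≤-trans i<ℓ ℓ≤i)))

      unaddressed-∷ : ∀ {i j k} → T (unaddressedAt k i) → T (unaddressed (suc i) j k) → T (unaddressed i j k)
      unaddressed-∷ {i} {j} {k} not-at-i unaddr = unaddressed⁺ not-at
        where
        not-at : ∀ ℓ → i ≤ℕ ℓ → ℓ ≤ℕ j → T (unaddressedAt k ℓ)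
        not-at ℓ i≤ℓ ℓ≤j with ℕ.m≤n⇒m<n∨m≡n i≤ℓ
        ... | inj₂ refl = not-at-i
        ... | inj₁ i<ℓ = unaddressed⁻ unaddr i<ℓ ℓ≤j

      addressed⇒¬fixedUnaddressed : ∀ i {k} → πσ (s i) ≡ just k → ¬ T (fixedUnaddressed i k)
      addressed⇒¬fixedUnaddressed i eq fixed with fixedUnaddressed⁻ fixed
      ... | j , i≤j , _ , _ , unaddr = unaddressed⇒≢ unaddr ℕ.≤-refl i≤j eq refl

      fixedUnaddressed-unfold : ∀ i {k} → i ≤ℕ t → T (unaddressedAt k i) →
                                fixedUnaddressed i k ≡ not (f k (s (suc i))) ∨ fixedUnaddressed (suc i) k
      fixedUnaddressed-unfold i {k} i≤t not-at-i = T-ext fold⁻ fold⁺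
        where
        fold⁻ : T (fixedUnaddressed i k) → T (not (f k (s (suc i))) ∨ fixedUnaddressed (suc i) k)
        fold⁻ fixed with fixedUnaddressed⁻ fixed
        ... | j , i≤j , j≤t , ¬fk , unaddr with ℕ.m≤n⇒m<n∨m≡n i≤j
        ...   | inj₂ refl = Equivalence.from T-∨ (inj₁ (T-not⁺ ¬fk))
        ...   | inj₁ i<j = Equivalence.from T-∨ (inj₂ (fixedUnaddressed⁺ i<j j≤t ¬fk (unaddressed-tail unaddr)))
        fold⁺ : T (not (f k (s (suc i))) ∨ fixedUnaddressed (suc i) k) → T (fixedUnaddressed i k)
        fold⁺ h with Equivalence.to T-∨ h
        ... | inj₁ ¬fk = fixedUnaddressed⁺ ℕ.≤-refl i≤t (T-not⁻ ¬fk)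
                           (unaddressed-∷ not-at-i unaddressed-∅)
        ... | inj₂ fixed-later with fixedUnaddressed⁻ fixed-later
        ...   | j , i<j , j≤t , ¬fk , unaddr = fixedUnaddressed⁺ (ℕ.<⇒≤ i<j) j≤t ¬fk (unaddressed-∷ not-at-i unaddr)

      primary-step : ∀ {j} q → q <ℕ t → T (primary j) → T (f j (s (suc q))) → T (unaddressedAt j (suc q)) →
                     T (f j (s (suc (suc q))))
      primary-step {j} q q<t prim fj not-at-q with flawed⇒πσ (s (suc q)) (s-flawed (suc q))
      ... | b , eq = primary-persists prim fj (πσ-flaw (s (suc q)) eq) b≢j (ρ-step-pos q q<t eq)
        where
        b≢j : b ≢ j
        b≢j refl = T-not⁻ (subst (λ x → T (not (maybeEq x j))) eq not-at-q) (finEq-refl j)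

      primary-stays : ∀ {j p j′} → T (primary j) → T (f j (s (suc p))) → j′ ≤ℕ t → T (unaddressed (suc p) j′ j) →
                      ∀ {ℓ} → suc p ≤′ ℓ → ℓ ≤ℕ suc j′ → T (f j (s ℓ))
      primary-stays prim fj j′≤t unaddr ≤′-refl _ = fj
      primary-stays prim fj j′≤t unaddr (≤′-step {zero} (≤′-reflexive ()))
      primary-stays {j′ = j′} prim fj j′≤t unaddr (≤′-step {suc q} p<q+1) q+2≤j′+1 =
        primary-step q (ℕ.≤-trans q+1≤j′ j′≤t) prim
          (primary-stays prim fj j′≤t unaddr p<q+1 (ℕ.≤-trans q+1≤j′ (ℕ.n≤1+n j′)))
          (unaddressed⁻ unaddr (ℕ.≤′⇒≤ p<q+1) q+1≤j′)
        where
        q+1≤j′ : suc q ≤ℕ j′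
        q+1≤j′ = ℕ.≤-pred q+2≤j′+1

      primary⇒¬fixedUnaddressed : ∀ p {j} → T (primary j) → T (f j (s (suc p))) → ¬ T (fixedUnaddressed (suc p) j)
      primary⇒¬fixedUnaddressed p prim fj fixed with fixedUnaddressed⁻ fixed
      ... | j′ , p<j′ , j′≤t , ¬fj , unaddr =
        ¬fj (primary-stays prim fj j′≤t unaddr (ℕ.≤⇒≤′ (ℕ.m≤n⇒m≤1+n p<j′)) ℕ.≤-refl)

      lookup-pending : ∀ i k → k ∈ˢ pending i ≡ f k (s i) ∧ not (fixedUnaddressed i k)
      lookup-pending i k =
        trans (Vec.lookup∘tabulate _ k) (cong (λ b → b ∧ not (fixedUnaddressed i k)) (lookup-U (s i) k))

      witnessAt-entry : ∀ i k → (k ∈ˢ Bset Σv i) ∧ not (k ∈ˢ Cset Σv i)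
                                  ≡ (k ∈ˢ Bset Σv i) ∧ not (fixedUnaddressed (suc i) k)
      witnessAt-entry i k = trans (cong (λ c → b ∧ not c) (lookup-Cset i k)) (∧-not-∧ b (fixedUnaddressed (suc i) k))
        where b = k ∈ˢ Bset Σv i

      lookup-witnessAt : ∀ i k → k ∈ˢ witnessAt i ≡ (k ∈ˢ Bset Σv i) ∧ not (fixedUnaddressed (suc i) k)
      lookup-witnessAt i k = trans (Vec.lookup∘tabulate _ k) (witnessAt-entry i k)

      pending-1 : pending 1 ≡ witnessAt 0
      pending-1 = Vec.tabulate-cong (λ k → sym (witnessAt-entry 0 k))

      firstπ-pending : ∀ i {a} → πσ (s i) ≡ just a → firstπ (pending i) ≡ just a
      firstπ-pending i {a} eq = firstπ-⊆ (U (s i)) (pending i) pending⊆U eq a∈pending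
        where
        pending⊆U : ∀ j → T (j ∈ˢ pending i) → T (j ∈ˢ U (s i))
        pending⊆U j h = subst T (sym (lookup-U (s i) j)) (T-∧ˡ (subst T (lookup-pending i j) h))
        a∈pending : T (a ∈ˢ pending i)
        a∈pending = subst T (sym (lookup-pending i a))
          (T-∧⁺ (πσ-flaw (s i) eq) (T-not⁺ (addressed⇒¬fixedUnaddressed i eq)))

      introduced≡Bset : ∀ p {a} → πσ (s (suc p)) ≡ just a →
                        introduced a (s (suc p)) (s (suc (suc p))) ≡ Bset Σv (suc p)
      introduced≡Bset p {a} eq = Vec.tabulate-cong introduced-at
        where
        σ = s (suc p)
        τ = s (suc (suc p))
        open ≡-Reasoning
        introduced-at : ∀ k → f k τ ∧ (not (f k σ) ∨ finEq k a) ≡ (k ∈ˢ U τ) ∧ not (k ∈ˢ remove (U σ) (πσ σ))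
        introduced-at k rewrite eq with k Fin.≟ a
        ... | yes refl = begin
          f k τ ∧ (not (f k σ) ∨ finEq k k) ≡⟨ cong (λ z → f k τ ∧ (not (f k σ) ∨ z)) (T⇒≡true (finEq-refl k)) ⟩
          f k τ ∧ (not (f k σ) ∨ true)      ≡⟨ cong (f k τ ∧_) (∨-zeroʳ (not (f k σ))) ⟩
          f k τ ∧ not false                 ≡⟨ sym (cong₂ (λ x y → x ∧ not y) (lookup-U τ k) removed) ⟩
          (k ∈ˢ U τ) ∧ not (k ∈ˢ (U σ [ k ]≔ false)) ∎
          where removed = Vec.lookup∘update k (U σ) false
        ... | no k≢a = begin
          f k τ ∧ (not (f k σ) ∨ finEq k a) ≡⟨ cong (λ z → f k τ ∧ (not (f k σ) ∨ z)) (finEq-≢ k≢a) ⟩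
          f k τ ∧ (not (f k σ) ∨ false)     ≡⟨ cong (f k τ ∧_) (∨-identityʳ (not (f k σ))) ⟩
          f k τ ∧ not (f k σ)               ≡⟨ sym (cong₂ (λ x y → x ∧ not y) (lookup-U τ k) kept) ⟩
          (k ∈ˢ U τ) ∧ not (k ∈ˢ (U σ [ a ]≔ false)) ∎
          where kept = trans (Vec.lookup∘update′ k≢a (U σ) false) (lookup-U σ k)

      lookup-Bset : ∀ p {a} → πσ (s (suc p)) ≡ just a → ∀ k →
                    k ∈ˢ Bset Σv (suc p) ≡ f k (s (suc (suc p))) ∧ (not (f k (s (suc p))) ∨ finEq k a)
      lookup-Bset p eq k = trans (cong (k ∈ˢ_) (sym (introduced≡Bset p eq))) (Vec.lookup∘tabulate _ k)

      pending-advance-addressed : ∀ p {a} → πσ (s (suc p)) ≡ just a →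
                                  (a ∈ˢ U (s (suc (suc p)))) ∧ not (fixedUnaddressed (suc (suc p)) a)
                                    ≡ (a ∈ˢ (pending (suc p) [ a ]≔ false)) ∨ (a ∈ˢ witnessAt (suc p))
      pending-advance-addressed p {a} eq = begin
        (a ∈ˢ U τ) ∧ not E′                  ≡⟨ cong (_∧ not E′) (lookup-U τ a) ⟩
        f a τ ∧ not E′                       ≡⟨ cong (_∧ not E′) (sym Bset-a) ⟩
        (a ∈ˢ Bset Σv (suc p)) ∧ not E′      ≡⟨ sym (lookup-witnessAt (suc p) a) ⟩
        a ∈ˢ witnessAt (suc p)               ≡⟨ cong (_∨ (a ∈ˢ witnessAt (suc p))) (sym removed) ⟩
        (a ∈ˢ (pending (suc p) [ a ]≔ false)) ∨ (a ∈ˢ witnessAt (suc p)) ∎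
        where
        open ≡-Reasoning
        σ = s (suc p)
        τ = s (suc (suc p))
        E′ = fixedUnaddressed (suc (suc p)) a
        removed = Vec.lookup∘update a (pending (suc p)) false
        Bset-a : a ∈ˢ Bset Σv (suc p) ≡ f a τ
        Bset-a = begin
          a ∈ˢ Bset Σv (suc p)                ≡⟨ lookup-Bset p eq a ⟩
          f a τ ∧ (not (f a σ) ∨ finEq a a)   ≡⟨ cong (λ z → f a τ ∧ (not (f a σ) ∨ z)) (T⇒≡true (finEq-refl a)) ⟩
          f a τ ∧ (not (f a σ) ∨ true)        ≡⟨ cong (f a τ ∧_) (∨-zeroʳ (not (f a σ))) ⟩
          f a τ ∧ true                        ≡⟨ ∧-identityʳ (f a τ) ⟩
          f a τ                               ∎

      pending-advance-other : ∀ p {a k} → p <ℕ t → πσ (s (suc p)) ≡ just a → k ≢ a →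
                              (k ∈ˢ U (s (suc (suc p)))) ∧ not (fixedUnaddressed (suc (suc p)) k)
                                ≡ (k ∈ˢ (pending (suc p) [ a ]≔ false)) ∨ (k ∈ˢ witnessAt (suc p))
      pending-advance-other p {a} {k} p<t eq k≢a = begin
        (k ∈ˢ U (s (suc (suc p)))) ∧ not E′               ≡⟨ cong (_∧ not E′) (lookup-U (s (suc (suc p))) k) ⟩
        u′ ∧ not E′                                       ≡⟨ sym (∧-not-∨-cases u u′ E′) ⟩
        (u ∧ not (not u′ ∨ E′)) ∨ ((u′ ∧ not u) ∧ not E′) ≡⟨ sym (cong₂ _∨_ pending-k witness-k) ⟩
        (k ∈ˢ (pending (suc p) [ a ]≔ false)) ∨ (k ∈ˢ witnessAt (suc p)) ∎
        where
        open ≡-Reasoning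
        u = f k (s (suc p))
        u′ = f k (s (suc (suc p)))
        E′ = fixedUnaddressed (suc (suc p)) k
        unaddressed-k : T (unaddressedAt k (suc p))
        unaddressed-k = subst (λ x → T (not (maybeEq x k))) (sym eq) (T-not⁺ (k≢a ∘ sym ∘ finEq⇒≡))
        unfold = fixedUnaddressed-unfold (suc p) p<t unaddressed-k
        pending-k : k ∈ˢ (pending (suc p) [ a ]≔ false) ≡ u ∧ not (not u′ ∨ E′)
        pending-k = begin
          k ∈ˢ (pending (suc p) [ a ]≔ false)   ≡⟨ Vec.lookup∘update′ k≢a (pending (suc p)) false ⟩
          k ∈ˢ pending (suc p)                   ≡⟨ lookup-pending (suc p) k ⟩
          u ∧ not (fixedUnaddressed (suc p) k)   ≡⟨ cong (λ e → u ∧ not e) unfold ⟩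
          u ∧ not (not u′ ∨ E′)                  ∎
        witness-k : k ∈ˢ witnessAt (suc p) ≡ (u′ ∧ not u) ∧ not E′
        witness-k = begin
          k ∈ˢ witnessAt (suc p)                 ≡⟨ lookup-witnessAt (suc p) k ⟩
          (k ∈ˢ Bset Σv (suc p)) ∧ not E′        ≡⟨ cong (_∧ not E′) (lookup-Bset p eq k) ⟩
          (u′ ∧ (not u ∨ finEq k a)) ∧ not E′    ≡⟨ cong (λ z → (u′ ∧ (not u ∨ z)) ∧ not E′) (finEq-≢ k≢a) ⟩
          (u′ ∧ (not u ∨ false)) ∧ not E′        ≡⟨ cong (λ z → (u′ ∧ z) ∧ not E′) (∨-identityʳ (not u)) ⟩
          (u′ ∧ not u) ∧ not E′                  ∎

      pending-advance : ∀ p → p <ℕ t → pending (suc (suc p)) ≡ advance (pending (suc p)) (witnessAt (suc p))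
      pending-advance p p<t with flawed⇒πσ (s (suc p)) (s-flawed (suc p))
      ... | a , eq = trans (Vec.tabulate-cong pending-at) (cong (λ r → remove S* r ∪ˢ witnessAt (suc p)) (sym first))
        where
        S* = pending (suc p)
        first = firstπ-pending (suc p) eq
        pending-at : ∀ k → (k ∈ˢ U (s (suc (suc p)))) ∧ not (fixedUnaddressed (suc (suc p)) k)
                             ≡ (k ∈ˢ (S* [ a ]≔ false)) ∨ (k ∈ˢ witnessAt (suc p))
        pending-at k with k Fin.≟ a
        ... | yes refl = pending-advance-addressed p eq
        ... | no k≢a = pending-advance-other p p<t eq k≢a

      inIn-witnessAt : ∀ p {a} → πσ (s (suc p)) ≡ just a →
                       T (inIn a (witnessAt (suc p)) (s (suc (suc p))) (s (suc p)))
      inIn-witnessAt p {a} eq =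
        T-∧⁺ (πσ-flaw (s (suc p)) eq)
             (subst (λ X → T (covers X (witnessAt (suc p)))) (sym (introduced≡Bset p eq))
                    (covers⁺ {Bset Σv (suc p)} {witnessAt (suc p)} witness⊆B primary-kept))
        where
        witness⊆B : ∀ j → T (j ∈ˢ witnessAt (suc p)) → T (j ∈ˢ Bset Σv (suc p))
        witness⊆B j h = T-∧ˡ (subst T (lookup-witnessAt (suc p) j) h)
        primary-kept : ∀ j → T (primary j) → T (j ∈ˢ Bset Σv (suc p)) → T (j ∈ˢ witnessAt (suc p))
        primary-kept j prim j∈B = subst T (sym (lookup-witnessAt (suc p) j))
          (T-∧⁺ j∈B (T-not⁺ (primary⇒¬fixedUnaddressed (suc p) prim fj)))
          where
          fj : T (f j (s (suc (suc p))))
          fj = T-∧ˡ (subst T (lookup-Bset p eq j) j∈B)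

      restrictedStep-witnessAt : ∀ p →
        restrictedStep (pending (suc p)) (witnessAt (suc p)) (s (suc p)) (s (suc (suc p))) ≡ stepWeight p
      restrictedStep-witnessAt p with flawed⇒πσ (s (suc p)) (s-flawed (suc p))
      ... | a , eq = trans (restrictedStep-just _ _ _ _ (firstπ-pending (suc p) eq) (inIn-witnessAt p eq))
                           (sym (step-just _ _ eq))

      laterWitnesses : Vec Sub t
      laterWitnesses = tabulate (witnessAt ∘ suc ∘ toℕ)

      chainWeight-witness : chainWeight (witnessAt 0) laterWitnesses (s ∘ suc) ≡ prodℚ (applyUpTo stepWeight t)
      chainWeight-witness =
        subst (λ S₁* → chainWeight S₁* laterWitnesses (s ∘ suc) ≡ prodℚ (applyUpTo stepWeight t)) pending-1
          (chainWeight-tabulate t (pending ∘ suc) (witnessAt ∘ suc) (s ∘ suc) stepWeight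
            pending-advance (λ p _ → restrictedStep-witnessAt p))

      weight≤witnessWeight : weight Σv ≤ maxRatio * witnessWeight (witness Σv) Σv
      weight≤witnessWeight = begin
        weight Σv                   ≡⟨ weight≡ ⟩
        θ (s 1) * Π                 ≤⟨ *-monoʳ-≤ Π-nonneg θ≤ ⟩
        (maxRatio * μ (s 1)) * Π    ≡⟨ ℚ.*-assoc maxRatio (μ (s 1)) Π ⟩
        maxRatio * (μ (s 1) * Π)    ≡⟨ cong (λ x → maxRatio * (μ (s 1) * x)) (sym chainWeight-witness) ⟩
        maxRatio * witnessWeight (witness Σv) Σv ∎
        where
        open ℚ.≤-Reasoning
        Π = prodℚ (applyUpTo stepWeight t)
        Π-nonneg : 0ℚ ≤ Π
        Π-nonneg = subst (0ℚ ≤_) chainWeight-witness (chainWeight-nonneg (witnessAt 0) laterWitnesses (s ∘ suc))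
        θ≤ : θ (s 1) ≤ maxRatio * μ (s 1)
        θ≤ = divℚ≤⇒≤* (θ (s 1)) (μ-pos (s 1)) (≤-foldr-⊔ (λ σ → divℚ (θ σ) (μ σ)) (∈-allFin (s 1)))

    maxRatio-nonneg : 0ℚ ≤ maxRatio
    maxRatio-nonneg = foldr-⊔-nonneg _ (allFin n)

    scaledWitnessWeight-nonneg : ∀ {t} v (φ : Vec Sub (suc t)) → 0ℚ ≤ maxRatio * witnessWeight φ v
    scaledWitnessWeight-nonneg v φ = *-nonneg maxRatio-nonneg (witnessWeight-nonneg φ v)

    failure≤witnessSum : ∀ t (v : Vec (Fin n) (suc t)) →
                         (if bad v then weight v else 0ℚ) ≤ sumMap (𝓕 t) (λ φ → maxRatio * witnessWeight φ v)
    failure≤witnessSum t v with bad v in bad-v | possible v in possible-v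
    ... | false | _ = sumMap-nonneg (𝓕 t) (scaledWitnessWeight-nonneg v)
    ... | true | false =
      ℚ.≤-trans (¬posᵇ⇒≤0 (subst T possible-v)) (sumMap-nonneg (𝓕 t) (scaledWitnessWeight-nonneg v))
    ... | true | true = ℚ.≤-trans (Trajectory.weight≤witnessWeight v (≡true⇒T bad-v) (≡true⇒T possible-v))
      (≤-sumMap (λ φ → maxRatio * witnessWeight φ v) (scaledWitnessWeight-nonneg v) witness∈𝓕)
      where
      witness∈𝓕 : witness v ∈ 𝓕 t
      witness∈𝓕 = ∈-deduplicate⁺ _≟W_ (∈-map⁺ witness
        (∈-filterᵇ⁺ (λ Σ → bad Σ ∧ possible Σ) (∈-allVecs (suc t) v) (≡true⇒T (cong₂ _∧_ bad-v possible-v))))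

    failProb≤bound : ∀ t → failProb t ≤ bound t
    failProb≤bound t = begin
      failProb t
        ≤⟨ sumMap-mono-≤ (allVecs (suc t)) (failure≤witnessSum t) ⟩
      sumMap (allVecs (suc t)) (λ v → sumMap (𝓕 t) (λ φ → maxRatio * witnessWeight φ v))
        ≡⟨ sumMap-swap (allVecs (suc t)) (𝓕 t) (λ v φ → maxRatio * witnessWeight φ v) ⟩
      sumMap (𝓕 t) (λ φ → sumMap (allVecs (suc t)) (λ v → maxRatio * witnessWeight φ v))
        ≡⟨ sumMap-cong (𝓕 t) (λ φ → sumMap-*ˡ (allVecs (suc t)) maxRatio (witnessWeight φ)) ⟩
      sumMap (𝓕 t) (λ φ → maxRatio * sumMap (allVecs (suc t)) (witnessWeight φ))
        ≤⟨ sumMap-mono-≤ (𝓕 t) (λ φ → *-monoˡ-≤ maxRatio-nonneg (sum-witnessWeight≤prodγ φ)) ⟩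
      sumMap (𝓕 t) (λ φ → maxRatio * prodγ φ)
        ≡⟨ sumMap-*ˡ (𝓕 t) maxRatio prodγ ⟩
      bound t ∎
      where open ℚ.≤-Reasoning

corollary3p3 : (n m : ℕ)
    (f : Fin m → Fin n → Bool)
    (ρ : Fin m → Fin n → Fin n → ℚ)
    (θ μ : Fin n → ℚ)
    (π : Permutation′ m) →
    (∀ i σ → f i σ ≡ true → IsProbDist (ρ i σ)) →
    IsProbDist θ →
    IsProbDist μ →
    (∀ σ → 0ℚ < μ σ) →
    (t : ℕ) →
    Setup.failProb n m f ρ θ μ π t ≤ Setup.bound n m f ρ θ μ π t
corollary3p3 n m f ρ θ μ π hρ _ hμ μ-pos =
  Strategy.Bounds.failProb≤bound n m f ρ θ μ π ρ-nonneg μ-pos (ℚ.≤-reflexive (proj₂ hμ))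
  where
  ρ-nonneg : ∀ {a σ} τ → T (f a σ) → 0ℚ ≤ ρ a σ τ
  ρ-nonneg {a} {σ} τ fa = proj₁ (hρ a σ (T⇒≡true fa)) τ
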